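{- Let $\lambda$ be a $d$-dimensional extractor, $I\subseteq\{1,\ldots,d\}$, $\mathbf{C}\subseteq\mathbb{N}^d$, and $J=\operatorname{extract}_{\lambda,I}(\mathbf{C})$. For every $i\in I\setminus J$ there exists $\mathbf{c}\in\mathbf{C}$ such that $\mathbf{c}(i)\ge\lambda_{|J|+1}$.
   Context: A $d$-dimensional extractor is a non-decreasing sequence $\lambda=(\lambda_0\le\lambda_1\le\cdots\le\lambda_{d+1})$ of positive natural numbers. Given $I\subseteq\{1,\ldots,d\}$ and $\mathbf{C}\subseteq\mathbb{N}^d$, a $(\lambda,I)$-small set of $\mathbf{C}$ is a set $J\subseteq I$ such that $\mathbf{c}(j)<\lambda_{|J|}$ for every $j\in J$ and every $\mathbf{c}\in\mathbf{C}$. The class of $(\lambda,I)$-small sets of $\mathbf{C}$ is nonempty and closed under union, and $\operatorname{extract}_{\lambda,I}(\mathbf{C})$ denotes its maximum element with respect to inclusion. -}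

module Defs where

open import Data.Nat using (ℕ; suc; _≤_; _<_)
open import Data.Fin using (Fin)
open import Data.Fin.Subset using (Subset; _∈_; _⊆_; ∣_∣)
open import Data.Product using (_×_)

-- Represented as a function ℕ → ℕ; only the values at indices 0 … d+1 matter
-- (all constraints refer only to those indices).
record Extractor (d : ℕ) : Set where
  field
    seq      : ℕ → ℕ
    positive : ∀ k → k ≤ suc d → 0 < seq k
    mono     : ∀ i j → i ≤ j → j ≤ suc d → seq i ≤ seq j

open Extractor public

-- ℕ^d vectors: Fin d → ℕ (coordinates 1..d are indexed 0..d-1).
-- A set C ⊆ ℕ^d is a predicate on vectors.

Small : ∀ {d} → Extractor d → Subset d → ((Fin d → ℕ) → Set) → Subset d → Set
Small {d} λ' I C J =
  (J ⊆ I) × (∀ (j : Fin d) → j ∈ J → ∀ (c : Fin d → ℕ) → C c → c j < seq λ' ∣ J ∣)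

IsExtract : ∀ {d} → Extractor d → Subset d → ((Fin d → ℕ) → Set) → Subset d → Set
IsExtract {d} λ' I C J =
  Small λ' I C J × (∀ (K : Subset d) → Small λ' I C K → K ⊆ J)

{-# OPTIONS --safe #-}
module Submission where

-- If every c ∈ C had c(i) < λ_{|J|+1}, then J ∪ {i} would still be (λ,I)-small: it has
-- |J| + 1 elements and λ is monotone, so the bounds inherited from J only weaken.
-- Maximality of J would then put i in J. Excluded middle turns this contradiction
-- into a witness.

open import Defs
open import Axiom.ExcludedMiddle using (ExcludedMiddle)
open import Level using (0ℓ)
open import Data.Nat using (ℕ; suc; _≤_; _<_)
open import Data.Nat.Properties using (≰⇒>; <-≤-trans; ≤-trans; n≤1+n; m≤n⇒m≤1+n)
open import Data.Fin using (Fin)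
open import Data.Fin.Subset using (Subset; _∈_; _∉_; _⊆_; _⊂_; _∪_; ⁅_⁆; ∣_∣)
open import Data.Fin.Subset.Properties
  using (∣p∣≤n; p⊂q⇒∣p∣<∣q∣; p⊆p∪q; q⊆p∪q; x∈p∪q⁻; x∈⁅x⁆; x∈⁅y⁆⇒x≡y)
open import Data.Product using (_×_; ∃; _,_)
open import Data.Sum using (inj₁; inj₂)
open import Data.Empty using (⊥-elim)
open import Relation.Binary.PropositionalEquality using (refl)
open import Relation.Nullary using (¬_; yes; no)

p⊂p∪⁅x⁆ : ∀ {n} {p : Subset n} {x} → x ∉ p → p ⊂ p ∪ ⁅ x ⁆
p⊂p∪⁅x⁆ {p = p} {x} x∉p = p⊆p∪q ⁅ x ⁆ , x , q⊆p∪q p ⁅ x ⁆ (x∈⁅x⁆ x) , x∉p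

module _ {d : ℕ} (λ' : Extractor d) where

  seq-mono-≤card : ∀ {m} (K : Subset d) → m ≤ ∣ K ∣ → seq λ' m ≤ seq λ' ∣ K ∣
  seq-mono-≤card K m≤∣K∣ = mono λ' _ ∣ K ∣ m≤∣K∣ (m≤n⇒m≤1+n (∣p∣≤n K))

  small-∪⁅⁆ : ∀ {I C J i} → Small λ' I C J → i ∈ I → i ∉ J →
              (∀ c → C c → c i < seq λ' (suc ∣ J ∣)) →
              Small λ' I C (J ∪ ⁅ i ⁆)
  small-∪⁅⁆ {I} {C} {J} {i} (J⊆I , J-small) i∈I i∉J i-bounded = K⊆I , K-small
    where
    K : Subset d
    K = J ∪ ⁅ i ⁆

    ∣J∣<∣K∣ : suc ∣ J ∣ ≤ ∣ K ∣
    ∣J∣<∣K∣ = p⊂q⇒∣p∣<∣q∣ (p⊂p∪⁅x⁆ i∉J)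

    K⊆I : K ⊆ I
    K⊆I j∈K with x∈p∪q⁻ J ⁅ i ⁆ j∈K
    ... | inj₁ j∈J  = J⊆I j∈J
    ... | inj₂ j∈⁅i⁆ with refl ← x∈⁅y⁆⇒x≡y i j∈⁅i⁆ = i∈I

    K-small : ∀ j → j ∈ K → ∀ c → C c → c j < seq λ' ∣ K ∣
    K-small j j∈K c c∈C with x∈p∪q⁻ J ⁅ i ⁆ j∈K
    ... | inj₁ j∈J =
      <-≤-trans (J-small j j∈J c c∈C) (seq-mono-≤card K (≤-trans (n≤1+n _) ∣J∣<∣K∣))
    ... | inj₂ j∈⁅i⁆ with refl ← x∈⁅y⁆⇒x≡y i j∈⁅i⁆ =
      <-≤-trans (i-bounded c c∈C) (seq-mono-≤card K ∣J∣<∣K∣)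

  extract-unbounded-outside : ∀ {I C J i} → IsExtract λ' I C J → i ∈ I → i ∉ J →
                              ¬ (∀ c → C c → c i < seq λ' (suc ∣ J ∣))
  extract-unbounded-outside {J = J} {i} (J-small , J-max) i∈I i∉J i-bounded =
    i∉J (J-max _ (small-∪⁅⁆ J-small i∈I i∉J i-bounded) (q⊆p∪q J ⁅ i ⁆ (x∈⁅x⁆ i)))

lemma27 : ExcludedMiddle 0ℓ →
    ∀ (d : ℕ) (λ' : Extractor d) (I : Subset d) (C : (Fin d → ℕ) → Set) (J : Subset d) →
    IsExtract λ' I C J →
    ∀ (i : Fin d) → i ∈ I → i ∉ J →
    ∃ λ (c : Fin d → ℕ) → C c × seq λ' (suc ∣ J ∣) ≤ c i
lemma27 lem d λ' I C J J-extract i i∈I i∉J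
  with lem {∃ λ c → C c × seq λ' (suc ∣ J ∣) ≤ c i}
... | yes witness = witness
... | no no-witness = ⊥-elim (extract-unbounded-outside λ' J-extract i∈I i∉J i-bounded)
  where
  i-bounded : ∀ c → C c → c i < seq λ' (suc ∣ J ∣)
  i-bounded c c∈C with lem {seq λ' (suc ∣ J ∣) ≤ c i}
  ... | yes λ≤ci = ⊥-elim (no-witness (c , c∈C , λ≤ci))
  ... | no λ≰ci  = ≰⇒> λ≰ci
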